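{- Let $p>1$, $m\ge1$ and $0\le s\le k$ be integers with $k\ge1$, and let $a=\lceil\log_2(p-1)\rceil$. Then \[\operatorname{forb}(m,3,p\cdot K_k^s)\ge\sum_{i=0}^{k-1}\binom{m}{i}2^{m-i}+(p-1)\left(\binom{m}{k}-\binom{k+a-1}{k}\right).\]
   Context: A $3$-matrix is a matrix with entries in $\{0,1,2\}$. A matrix is simple if it has no repeated columns. For matrices $F$ and $A$, $A$ avoids $F$ if no submatrix of $A$ is a row and column permutation of $F$. $\operatorname{forb}(m,3,F)$ is the maximum number of columns of a simple $m$-rowed $3$-matrix that avoids $F$. $K_k^s$ is the $k\times\binom{k}{s}$ $(0,1)$-matrix whose columns are all distinct $(0,1)$-vectors of length $k$ with exactly $s$ ones. $p\cdot F$ denotes $p$ copies of $F$ placed side by side. Binomial coefficients $\binom{n}{k}$ with $n<k$ are $0$. -}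

module Defs where

open import Data.Nat using (ℕ; zero; suc; _+_; _*_; _∸_; _^_)
open import Data.Nat.Combinatorics using (_C_)
open import Data.Nat.Logarithm using (⌈log₂_⌉)
open import Data.Fin using (Fin; zero; suc)
open import Data.Vec using (Vec; []; _∷_)
import Data.Vec as Vec
open import Data.List using (List; []; _∷_; _++_; map; length; lookup; concat; replicate)
open import Data.List.Relation.Unary.Unique.Propositional using (Unique)
open import Data.Integer using (ℤ; +_; _-_) renaming (_+_ to _+ℤ_; _*_ to _*ℤ_)
open import Data.Product using (Σ; _×_)
open import Function.Definitions using (Injective)
open import Relation.Binary.PropositionalEquality using (_≡_)
open import Relation.Nullary using (¬_)

-- A 3-matrix with m rows, represented as the list of its columns.
-- Entries are in Fin 3 = {0,1,2}.
Matrix3 : ℕ → Set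
Matrix3 m = List (Vec (Fin 3) m)

ncols : ∀ {m} → Matrix3 m → ℕ
ncols = length

entry : ∀ {m} (A : Matrix3 m) → Fin m → Fin (length A) → Fin 3
entry A i j = Vec.lookup (lookup A j) i

Simple : ∀ {m} → Matrix3 m → Set
Simple A = Unique A

-- Row/column permutations are absorbed into the
-- (ordered) injective choices r and c.
Contains : ∀ {k m} → Matrix3 k → Matrix3 m → Set
Contains {k} {m} F A =
  Σ (Fin k → Fin m) λ r → Injective _≡_ _≡_ r ×
  Σ (Fin (length F) → Fin (length A)) λ c → Injective _≡_ _≡_ c ×
  (∀ i j → entry A (r i) (c j) ≡ entry F i j)

Avoids : ∀ {k m} → Matrix3 m → Matrix3 k → Set
Avoids A F = ¬ Contains F A

weightVecs : (k s : ℕ) → List (Vec (Fin 3) k)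
weightVecs zero zero = [] ∷ []
weightVecs zero (suc s) = []
weightVecs (suc k) zero = map (zero ∷_) (weightVecs k zero)
weightVecs (suc k) (suc s) =
  map (zero ∷_) (weightVecs k (suc s)) ++ map (suc zero ∷_) (weightVecs k s)

K : (k s : ℕ) → Matrix3 k
K k s = weightVecs k s

copies : ∀ {k} → ℕ → Matrix3 k → Matrix3 k
copies p F = concat (replicate p F)

sumBelow : ℕ → (ℕ → ℕ) → ℕ
sumBelow zero f = 0
sumBelow (suc n) f = sumBelow n f + f n

-- right-hand side of Proposition 3.5 (as an integer, since the second
-- summand may be negative)
bound : (p m k : ℕ) → ℤ
bound p m k =
  + sumBelow k (λ i → (m C i) * 2 ^ (m ∸ i))
  +ℤ (+ (p ∸ 1)) *ℤ ((+ (m C k)) - (+ ((k + a ∸ 1) C k)))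
  where
  a = ⌈log₂ (p ∸ 1) ⌉

module Submission where

-- Put q = p ∸ 1 and let
-- w = 0^(k∸s) 1^s.  A column *matches* a k-set R of rows if it reads w on R
-- (rows in increasing order).  If A contains p·K_k^s on R, the column of
-- K_k^s that reads w back through the row order occurs p times, so p columns
-- of A match R (`contains⇒matches`).  So it suffices to build a simple A in
-- which every k-set is matched by at most q columns.
--
-- Scan a column greedily for w.  A = avoiders ++ extras: the avoiders are
-- the Σ_{i<k} C(m,i) 2^(m-i) columns whose scan never finishes (they match
-- nothing); the extras finish exactly at their last advance, with q columns
-- per advance set, split by halving q at stay rows between the letter 2 and
-- a non-advancing decoy letter (`extras-few-matches`).  With a = ⌈log₂ q⌉
-- nothing is lost on advance sets with ≥ a halving rows; the others (the
-- deficit) number at most C(k+a-1, k), since stay rows just before the first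
-- 1 do not halve (`deficit-bound`).

open import Defs
open import Data.Nat
open import Data.Nat.Properties
open import Data.Nat.Induction using (<-rec)
open import Data.Nat.Combinatorics using (_C_; nCk+nC[k+1]≡[n+1]C[k+1]; k>n⇒nCk≡0)
open import Data.Nat.Logarithm using (⌈log₂_⌉; ⌈log₂2^n⌉≡n; ⌈log₂⌉-mono-≤; ⌈log₂⌈n/2⌉⌉≡⌈log₂n⌉∸1)
open import Data.Nat.Tactic.RingSolver using (solve-∀)
open import Algebra.Properties.CommutativeMonoid.Sum +-0-commutativeMonoid using (sum; sum-cong-≗; ∑-distrib-+; sum-replicate-zero)
open import Data.Bool using (Bool; true; false; _∨_)
open import Data.Bool.Properties using (∨-zeroʳ)
open import Data.Fin using (Fin; zero; suc; punchIn; punchOut)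
import Data.Fin.Properties as FinP
open import Data.Vec using (Vec; []; _∷_; tabulate)
import Data.Vec as Vec
open import Data.Vec.Properties using (∷-injectiveˡ; ∷-injectiveʳ; lookup∘tabulate)
open import Data.List using (List; []; _∷_; _++_; map; length; lookup; concat; replicate)
open import Data.List.Properties using (length-++; length-map)
open import Data.List.Membership.Propositional using (_∈_)
open import Data.List.Membership.Propositional.Properties using (∈-map⁺; ∈-map⁻; ∈-++⁺ˡ; ∈-++⁺ʳ; ∈-++⁻)
open import Data.List.Relation.Unary.Any using (here; there; index)
open import Data.List.Relation.Unary.Any.Properties using (lookup-index)
import Data.List.Relation.Unary.All as All
import Data.List.Relation.Unary.AllPairs as AllPairs
open import Data.List.Relation.Unary.Unique.Propositional using (Unique)
import Data.List.Relation.Unary.Unique.Propositional.Properties as Unique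
open import Data.List.Relation.Binary.Disjoint.Propositional using (Disjoint)
open import Data.Product using (_×_; _,_; proj₁; proj₂; Σ; ∃)
open import Data.Sum using (inj₁; inj₂)
open import Data.Empty using (⊥; ⊥-elim)
open import Function.Definitions using (Injective)
open import Relation.Nullary using (Dec; yes; no; ¬_)
open import Relation.Nullary.Decidable using (_×-dec_)
open import Relation.Binary.PropositionalEquality
open import Data.Integer using (ℤ) renaming (_≤_ to _≤ℤ_)
import Data.Integer as ℤ
import Data.Integer.Properties as ℤP
import Data.Integer.Tactic.RingSolver as ℤSolver

indicator : {P : Set} → Dec P → ℕ
indicator (yes _) = 1
indicator (no _) = 0

count : {A : Set} {P : A → Set} → (∀ x → Dec (P x)) → List A → ℕ
count d [] = 0
count d (x ∷ xs) = indicator (d x) + count d xs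

count-++ : {A : Set} {P : A → Set} (d : ∀ x → Dec (P x)) (xs ys : List A) →
  count d (xs ++ ys) ≡ count d xs + count d ys
count-++ d [] ys = refl
count-++ d (x ∷ xs) ys =
  trans (cong (indicator (d x) +_) (count-++ d xs ys)) (sym (+-assoc (indicator (d x)) (count d xs) (count d ys)))

indicator-mono : {P Q : Set} (dP : Dec P) (dQ : Dec Q) → (P → Q) → indicator dP ≤ indicator dQ
indicator-mono (yes p) (yes _) _ = ≤-refl
indicator-mono (yes p) (no ¬q) f = ⊥-elim (¬q (f p))
indicator-mono (no _) _ _ = z≤n

count-map-≤ : {A B : Set} {P : B → Set} {Q : A → Set} (dP : ∀ x → Dec (P x)) (dQ : ∀ x → Dec (Q x))
  (f : A → B) → (∀ x → P (f x) → Q x) → ∀ xs → count dP (map f xs) ≤ count dQ xs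
count-map-≤ dP dQ f h [] = z≤n
count-map-≤ dP dQ f h (x ∷ xs) = +-mono-≤ (indicator-mono (dP (f x)) (dQ x) (h x)) (count-map-≤ dP dQ f h xs)

count-map-none : {A B : Set} {P : B → Set} (dP : ∀ x → Dec (P x))
  (f : A → B) → (∀ x → ¬ P (f x)) → ∀ xs → count dP (map f xs) ≤ 0
count-map-none dP f h [] = z≤n
count-map-none dP f h (x ∷ xs) with dP (f x)
... | yes p = ⊥-elim (h x p)
... | no _ = count-map-none dP f h xs

count-∈ : {A : Set} {P : A → Set} (d : ∀ x → Dec (P x)) {x : A} {xs : List A} → x ∈ xs → P x → 1 ≤ count d xs
count-∈ d {x} (here refl) px with d x
... | yes _ = s≤s z≤n
... | no ¬p = ⊥-elim (¬p px)
count-∈ d {xs = y ∷ xs} (there x∈xs) px = ≤-trans (count-∈ d x∈xs px) (m≤n+m (count d xs) (indicator (d y)))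

-- Pigeonhole: p distinct positions of xs, all satisfying P, force count ≥ p.
-- The position hitting the head (if any) is removed with punchIn/punchOut.
count-≥-injection : ∀ {A : Set} {P : A → Set} (d : ∀ x → Dec (P x)) (xs : List A) p (g : Fin p → Fin (length xs)) →
  Injective _≡_ _≡_ g → (∀ t → P (lookup xs (g t))) → p ≤ count d xs
count-≥-injection d [] zero g inj h = z≤n
count-≥-injection d [] (suc p) g inj h with g zero
... | ()
count-≥-injection {P = P} d (x ∷ xs) p g inj h with FinP.any? (λ t → zero FinP.≟ g t)
... | no misses = ≤-trans (count-≥-injection d xs p g′ inj′ h′) (m≤n+m (count d xs) (indicator (d x)))
  where
  0≢g : ∀ t → zero ≢ g t
  0≢g t e = misses (t , e)
  g′ : Fin p → Fin (length xs)
  g′ t = punchOut (0≢g t)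
  inj′ : Injective _≡_ _≡_ g′
  inj′ e = inj (FinP.punchOut-injective (0≢g _) (0≢g _) e)
  h′ : ∀ t → P (lookup xs (g′ t))
  h′ t = subst (λ f → P (lookup (x ∷ xs) f)) (sym (FinP.punchIn-punchOut (0≢g t))) (h t)
count-≥-injection {P = P} d (x ∷ xs) (suc p) g inj h | yes (t₀ , e₀) with d x
... | no ¬px = ⊥-elim (¬px (subst (λ f → P (lookup (x ∷ xs) f)) (sym e₀) (h t₀)))
... | yes _ = s≤s (count-≥-injection d xs p g′ inj′ h′)
  where
  0≢g : ∀ t → zero ≢ g (punchIn t₀ t)
  0≢g t e = FinP.punchInᵢ≢i t₀ t (inj (trans (sym e) e₀))
  g′ : Fin p → Fin (length xs)
  g′ t = punchOut (0≢g t)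
  inj′ : Injective _≡_ _≡_ g′
  inj′ e = FinP.punchIn-injective t₀ _ _ (inj (FinP.punchOut-injective (0≢g _) (0≢g _) e))
  h′ : ∀ t → P (lookup xs (g′ t))
  h′ t = subst (λ f → P (lookup (x ∷ xs) f)) (sym (FinP.punchIn-punchOut (0≢g t))) (h (punchIn t₀ t))

disjoint-prefixed : ∀ {m} {a b : Fin 3} → a ≢ b → (xs ys : List (Vec (Fin 3) m)) →
  Disjoint (map (a ∷_) xs) (map (b ∷_) ys)
disjoint-prefixed a≢b xs ys (p , q) with ∈-map⁻ (_ ∷_) p | ∈-map⁻ (_ ∷_) q
... | _ , _ , e₁ | _ , _ , e₂ = a≢b (∷-injectiveˡ (trans (sym e₁) e₂))

disjoint-++ʳ : {A : Set} {xs ys zs : List A} → Disjoint xs ys → Disjoint xs zs → Disjoint xs (ys ++ zs)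
disjoint-++ʳ {ys = ys} d₁ d₂ (p , q) with ∈-++⁻ ys q
... | inj₁ q′ = d₁ (p , q′)
... | inj₂ q′ = d₂ (p , q′)

unique-prefixed : ∀ {m} (a : Fin 3) {xs : List (Vec (Fin 3) m)} → Unique xs → Unique (map (a ∷_) xs)
unique-prefixed a u = Unique.map⁺ ∷-injectiveʳ u

index-++ˡ : {A : Set} (xs ys : List A) → Fin (length xs) → Fin (length (xs ++ ys))
index-++ˡ (x ∷ xs) ys zero = zero
index-++ˡ (x ∷ xs) ys (suc i) = suc (index-++ˡ xs ys i)

index-++ʳ : {A : Set} (xs ys : List A) → Fin (length ys) → Fin (length (xs ++ ys))
index-++ʳ [] ys i = i
index-++ʳ (x ∷ xs) ys i = suc (index-++ʳ xs ys i)

lookup-++ˡ : ∀ {A : Set} (xs ys : List A) i → lookup (xs ++ ys) (index-++ˡ xs ys i) ≡ lookup xs i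
lookup-++ˡ (x ∷ xs) ys zero = refl
lookup-++ˡ (x ∷ xs) ys (suc i) = lookup-++ˡ xs ys i

lookup-++ʳ : ∀ {A : Set} (xs ys : List A) i → lookup (xs ++ ys) (index-++ʳ xs ys i) ≡ lookup ys i
lookup-++ʳ [] ys i = refl
lookup-++ʳ (x ∷ xs) ys i = lookup-++ʳ xs ys i

index-++ʳ-injective : {A : Set} (xs ys : List A) {i j : Fin (length ys)} →
  index-++ʳ xs ys i ≡ index-++ʳ xs ys j → i ≡ j
index-++ʳ-injective [] ys e = e
index-++ʳ-injective (x ∷ xs) ys e = index-++ʳ-injective xs ys (FinP.suc-injective e)

index-++ˡ≢index-++ʳ : ∀ {A : Set} (xs ys : List A) i j → index-++ˡ xs ys i ≢ index-++ʳ xs ys j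
index-++ˡ≢index-++ʳ (x ∷ xs) ys zero j ()
index-++ˡ≢index-++ʳ (x ∷ xs) ys (suc i) j e = index-++ˡ≢index-++ʳ xs ys i j (FinP.suc-injective e)

∈-copies : ∀ {A : Set} {v : A} (xs : List A) → v ∈ xs → ∀ p →
  Σ (Fin p → Fin (length (concat (replicate p xs)))) λ e →
    Injective _≡_ _≡_ e × (∀ t → lookup (concat (replicate p xs)) (e t) ≡ v)
∈-copies xs v∈xs zero = (λ ()) , (λ {a} → ⊥-elim (no-position a)) , λ ()
  where
  no-position : Fin 0 → ⊥
  no-position ()
∈-copies {A} {v} xs v∈xs (suc p) with ∈-copies xs v∈xs p
... | e , e-inj , e-lookup = e′ , e′-inj , e′-lookup
  where
  rest : List A
  rest = concat (replicate p xs)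
  e′ : Fin (suc p) → Fin (length (xs ++ rest))
  e′ zero = index-++ˡ xs rest (index v∈xs)
  e′ (suc t) = index-++ʳ xs rest (e t)
  e′-inj : Injective _≡_ _≡_ e′
  e′-inj {zero} {zero} _ = refl
  e′-inj {zero} {suc b} eq = ⊥-elim (index-++ˡ≢index-++ʳ xs rest _ (e b) eq)
  e′-inj {suc a} {zero} eq = ⊥-elim (index-++ˡ≢index-++ʳ xs rest _ (e a) (sym eq))
  e′-inj {suc a} {suc b} eq = cong suc (e-inj (index-++ʳ-injective xs rest eq))
  e′-lookup : ∀ t → lookup (xs ++ rest) (e′ t) ≡ v
  e′-lookup zero = trans (lookup-++ˡ xs rest (index v∈xs)) (sym (lookup-index v∈xs))
  e′-lookup (suc t) = trans (lookup-++ʳ xs rest (e t)) (e-lookup t)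

⌈q/2⌉≤2^[a∸1] : ∀ q a → q ≤ 2 ^ a → ⌈ q /2⌉ ≤ 2 ^ (a ∸ 1)
⌈q/2⌉≤2^[a∸1] q zero q≤1 = ≤-trans (⌈n/2⌉≤n q) q≤1
⌈q/2⌉≤2^[a∸1] q (suc a) q≤ =
  ≤-trans (⌈n/2⌉-mono (≤-trans q≤ (≤-reflexive twice))) (≤-reflexive (sym (n≡⌈n+n/2⌉ (2 ^ a))))
  where
  twice : 2 ^ suc a ≡ 2 ^ a + 2 ^ a
  twice = cong (2 ^ a +_) (+-identityʳ (2 ^ a))

⌊q/2⌋≤2^[a∸1] : ∀ q a → q ≤ 2 ^ a → ⌊ q /2⌋ ≤ 2 ^ (a ∸ 1)
⌊q/2⌋≤2^[a∸1] q a q≤ = ≤-trans (⌊n/2⌋≤⌈n/2⌉ q) (⌈q/2⌉≤2^[a∸1] q a q≤)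

⌈q/2⌉+⌊q/2⌋≡q : ∀ q → ⌈ q /2⌉ + ⌊ q /2⌋ ≡ q
⌈q/2⌉+⌊q/2⌋≡q q = trans (+-comm ⌈ q /2⌉ ⌊ q /2⌋) (⌊n/2⌋+⌈n/2⌉≡n q)

n≤2^⌈log₂n⌉ : ∀ n → n ≤ 2 ^ ⌈log₂ n ⌉
n≤2^⌈log₂n⌉ = <-rec (λ n → n ≤ 2 ^ ⌈log₂ n ⌉) step
  where
  step : ∀ n → (∀ {m} → m < n → m ≤ 2 ^ ⌈log₂ m ⌉) → n ≤ 2 ^ ⌈log₂ n ⌉
  step zero _ = z≤n
  step (suc zero) _ = m^n>0 2 ⌈log₂ 1 ⌉
  step n@(suc (suc n′)) ih = begin
      n                           ≡⟨ sym (⌊n/2⌋+⌈n/2⌉≡n n) ⟩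
      ⌊ n /2⌋ + ⌈ n /2⌉           ≤⟨ +-monoˡ-≤ ⌈ n /2⌉ (⌊n/2⌋≤⌈n/2⌉ n) ⟩
      ⌈ n /2⌉ + ⌈ n /2⌉           ≤⟨ +-mono-≤ half≤ half≤ ⟩
      2 ^ (L ∸ 1) + 2 ^ (L ∸ 1)   ≡⟨ cong (2 ^ (L ∸ 1) +_) (sym (+-identityʳ _)) ⟩
      2 ^ suc (L ∸ 1)             ≡⟨ cong (2 ^_) (trans (+-comm 1 (L ∸ 1)) (m∸n+n≡m 1≤L)) ⟩
      2 ^ L                       ∎
    where
    open ≤-Reasoning
    L : ℕ
    L = ⌈log₂ n ⌉
    1≤L : 1 ≤ L
    1≤L = subst (_≤ L) (⌈log₂2^n⌉≡n 1) (⌈log₂⌉-mono-≤ {2} {n} (s≤s (s≤s z≤n)))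
    half≤ : ⌈ n /2⌉ ≤ 2 ^ (L ∸ 1)
    half≤ = subst (λ e → ⌈ n /2⌉ ≤ 2 ^ e) (⌈log₂⌈n/2⌉⌉≡⌈log₂n⌉∸1 n) (ih (⌈n/2⌉<n n′))

C-suc : ∀ m n → m C n ≤ suc m C n
C-suc m zero = ≤-refl
C-suc m (suc n) = ≤-trans (m≤n+m (m C suc n) (m C n)) (≤-reflexive (nCk+nC[k+1]≡[n+1]C[k+1] m n))

C-monoˡ : ∀ {m m′} n → m ≤ m′ → m C n ≤ m′ C n
C-monoˡ {m} n m≤m′ with m≤n⇒∃[o]m+o≡n m≤m′
... | o , refl = go o
  where
  go : ∀ o → m C n ≤ (m + o) C n
  go zero = ≤-reflexive (cong (_C n) (sym (+-identityʳ m)))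
  go (suc o) = ≤-trans (go o) (≤-trans (C-suc (m + o) n) (≤-reflexive (cong (_C n) (sym (+-suc m o)))))

-- The number of ternary words of length m avoiding a fixed word of length n
-- as a subsequence: Σ_{i<n} C(m,i) 2^(m-i).
avoiderCount : ℕ → ℕ → ℕ
avoiderCount m n = sumBelow n (λ i → (m C i) * 2 ^ (m ∸ i))

avoiderCount-empty : ∀ n → avoiderCount 0 (suc n) ≡ 1
avoiderCount-empty zero = refl
avoiderCount-empty (suc n) = trans (+-identityʳ (avoiderCount 0 (suc n))) (avoiderCount-empty n)

-- The recurrence of avoiders: the first letter either advances the scan or
-- is one of the two non-advancing letters.
avoiderCount-step : ∀ m n → avoiderCount (suc m) (suc n) ≡ avoiderCount m n + 2 * avoiderCount m (suc n)
avoiderCount-step m zero = solve-∀′ (2 ^ m)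
  where
  solve-∀′ : ∀ x → 0 + 1 * (2 * x) ≡ 0 + 2 * (0 + 1 * x)
  solve-∀′ = solve-∀
avoiderCount-step m (suc n) = begin
    T (suc m) (suc n) + (suc m C suc n) * 2 ^ (m ∸ n)
  ≡⟨ cong₂ _+_ (avoiderCount-step m n) (cong (_* 2 ^ (m ∸ n)) (sym (nCk+nC[k+1]≡[n+1]C[k+1] m n))) ⟩
    (T m n + 2 * T m (suc n)) + ((m C n) + (m C suc n)) * 2 ^ (m ∸ n)
  ≡⟨ cong ((T m n + 2 * T m (suc n)) +_) (*-distribʳ-+ (2 ^ (m ∸ n)) (m C n) (m C suc n)) ⟩
    (T m n + 2 * T m (suc n)) + ((m C n) * 2 ^ (m ∸ n) + (m C suc n) * 2 ^ (m ∸ n))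
  ≡⟨ cong (λ x → (T m n + 2 * T m (suc n)) + ((m C n) * 2 ^ (m ∸ n) + x)) next-term ⟩
    (T m n + 2 * T m (suc n)) + ((m C n) * 2 ^ (m ∸ n) + 2 * ((m C suc n) * 2 ^ (m ∸ suc n)))
  ≡⟨ regroup (T m n) (T m (suc n)) (m C n) ((m C suc n) * 2 ^ (m ∸ suc n)) (2 ^ (m ∸ n)) ⟩
    T m (suc n) + 2 * T m (suc (suc n))
  ∎
  where
  open ≡-Reasoning
  T : ℕ → ℕ → ℕ
  T = avoiderCount
  regroup : ∀ tn t1 c0 c1Y X → (tn + 2 * t1) + (c0 * X + 2 * c1Y) ≡ (tn + c0 * X) + 2 * (t1 + c1Y)
  regroup = solve-∀
  -- C(m,n+1) 2^(m-n) = 2 C(m,n+1) 2^(m-n-1); both sides vanish when n ≥ m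
  next-term : (m C suc n) * 2 ^ (m ∸ n) ≡ 2 * ((m C suc n) * 2 ^ (m ∸ suc n))
  next-term with n <? m
  ... | yes n<m = trans (cong (λ e → (m C suc n) * 2 ^ e) (+-∸-assoc 1 n<m)) (swap (m C suc n) (2 ^ (m ∸ suc n)))
    where
    swap : ∀ c y → c * (2 * y) ≡ 2 * (c * y)
    swap = solve-∀
  ... | no n≮m rewrite k>n⇒nCk≡0 {m} {suc n} (s≤s (≮⇒≥ n≮m)) = refl

k∸j≡suc[k∸sucj] : ∀ {k j} → j < k → k ∸ j ≡ suc (k ∸ suc j)
k∸j≡suc[k∸sucj] j<k = +-∸-assoc 1 j<k

ifSet : Bool → ℕ → ℕ
ifSet true n = n
ifSet false n = 0

sum-ones : ∀ n → sum {n} (λ _ → 1) ≡ n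
sum-ones zero = refl
sum-ones (suc n) = cong suc (sum-ones n)

sum-zero : ∀ {n} (f : Fin n → ℕ) → (∀ x → f x ≡ 0) → sum f ≡ 0
sum-zero {n} f f≡0 = trans (sum-cong-≗ f≡0) (sum-replicate-zero n)

_==_ : ∀ {n} → Fin n → Fin n → Bool
zero == zero = true
zero == suc _ = false
suc _ == zero = false
suc a == suc b = a == b

==-sound : ∀ {n} (a b : Fin n) → (a == b) ≡ true → a ≡ b
==-sound zero zero _ = refl
==-sound (suc a) (suc b) e = cong suc (==-sound a b e)

==-refl : ∀ {n} (a : Fin n) → (a == a) ≡ true
==-refl zero = refl
==-refl (suc a) = ==-refl a

sum-point : ∀ {m} (x₀ : Fin m) (g : Fin m → ℕ) → sum (λ x → ifSet (x₀ == x) (g x)) ≡ g x₀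
sum-point {suc m} zero g = trans (cong (g zero +_) (sum-zero {m} (λ x → ifSet (zero == suc x) (g (suc x))) (λ _ → refl))) (+-identityʳ _)
sum-point {suc m} (suc x₀) g = sum-point x₀ (λ i → g (suc i))

inImage : ∀ {k m} → (Fin k → Fin m) → Fin m → Bool
inImage {zero} r x = false
inImage {suc k} r x = (r zero == x) ∨ inImage (λ i → r (suc i)) x

inImage-sound : ∀ {k m} (r : Fin k → Fin m) x → inImage r x ≡ true → ∃ λ i → r i ≡ x
inImage-sound {suc k} r x e with r zero == x in e₀
... | true = zero , ==-sound _ _ e₀
... | false with inImage-sound (λ i → r (suc i)) x e
...   | i , eᵢ = suc i , eᵢ

inImage-complete : ∀ {k m} (r : Fin k → Fin m) i → inImage r (r i) ≡ true
inImage-complete r zero rewrite ==-refl (r zero) = refl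
inImage-complete r (suc i) rewrite inImage-complete (λ j → r (suc j)) i = ∨-zeroʳ (r zero == r (suc i))

sum-injection : ∀ {k m} (r : Fin k → Fin m) → Injective _≡_ _≡_ r → ∀ (g : Fin m → ℕ) →
  sum (λ i → g (r i)) ≡ sum (λ x → ifSet (inImage r x) (g x))
sum-injection {zero} r inj g = sym (sum-zero (λ x → ifSet (inImage r x) (g x)) (λ _ → refl))
sum-injection {suc k} {m} r inj g = begin
    g (r zero) + sum (λ i → g (r′ i))
  ≡⟨ cong (g (r zero) +_) (sum-injection r′ inj′ g) ⟩
    g (r zero) + sum (λ x → ifSet (inImage r′ x) (g x))
  ≡⟨ cong (_+ sum (λ x → ifSet (inImage r′ x) (g x))) (sym (sum-point (r zero) g)) ⟩
    sum (λ x → ifSet (r zero == x) (g x)) + sum (λ x → ifSet (inImage r′ x) (g x))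
  ≡⟨ sym (∑-distrib-+ (λ x → ifSet (r zero == x) (g x)) (λ x → ifSet (inImage r′ x) (g x))) ⟩
    sum (λ x → ifSet (r zero == x) (g x) + ifSet (inImage r′ x) (g x))
  ≡⟨ sum-cong-≗ pointwise ⟩
    sum (λ x → ifSet (inImage r x) (g x))
  ∎
  where
  open ≡-Reasoning
  r′ : Fin k → Fin m
  r′ i = r (suc i)
  inj′ : Injective _≡_ _≡_ r′
  inj′ e = FinP.suc-injective (inj e)
  -- r zero is not in the image of r′, so the two indicators never overlap
  pointwise : ∀ x → ifSet (r zero == x) (g x) + ifSet (inImage r′ x) (g x) ≡ ifSet (inImage r x) (g x)
  pointwise x with r zero == x in e₁ | inImage r′ x in e₂
  ... | true | true with inImage-sound r′ x e₂
  ...   | i , eᵢ with inj (trans (==-sound _ _ e₁) (sym eᵢ))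
  ...     | ()
  pointwise x | true | false = +-identityʳ _
  pointwise x | false | true = refl
  pointwise x | false | false = refl

+-mono-≤-interchange : ∀ {x₁ x₂} y₁ z₁ y₂ z₂ → x₁ ≤ y₁ + z₁ → x₂ ≤ y₂ + z₂ →
  x₁ + x₂ ≤ (y₁ + y₂) + (z₁ + z₂)
+-mono-≤-interchange y₁ z₁ y₂ z₂ p q = ≤-trans (+-mono-≤ p q) (≤-reflexive (interchange y₁ z₁ y₂ z₂))
  where
  interchange : ∀ a b c d → (a + b) + (c + d) ≡ (a + c) + (b + d)
  interchange = solve-∀

zero₃ one₃ two₃ : Fin 3
zero₃ = zero
one₃ = suc zero
two₃ = suc (suc zero)

toggle : Fin 3 → Fin 3
toggle zero = one₃
toggle (suc zero) = zero₃
toggle (suc (suc zero)) = two₃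

countTrue : ∀ {m} → Vec Bool m → ℕ
countTrue [] = 0
countTrue (b ∷ v) = ifSet b 1 + countTrue v

countTrue-tabulate : ∀ {m} (f : Fin m → Bool) → countTrue (tabulate f) ≡ sum (λ x → ifSet (f x) 1)
countTrue-tabulate {zero} f = refl
countTrue-tabulate {suc m} f = cong (ifSet (f zero) 1 +_) (countTrue-tabulate (λ i → f (suc i)))

isOne : Fin 3 → ℕ
isOne (suc zero) = 1
isOne _ = 0

ones : ∀ {n} → Vec (Fin 3) n → ℕ
ones [] = 0
ones (y ∷ v) = isOne y + ones v

ones-tabulate : ∀ {n} (f : Fin n → Fin 3) → ones (tabulate f) ≡ sum (λ i → isOne (f i))
ones-tabulate {zero} f = refl
ones-tabulate {suc n} f = cong (isOne (f zero) +_) (ones-tabulate (λ i → f (suc i)))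

∈-weightVecs : ∀ k s (v : Vec (Fin 3) k) → (∀ i → Vec.lookup v i ≢ two₃) → ones v ≡ s → v ∈ weightVecs k s
∈-weightVecs zero zero [] _ _ = here refl
∈-weightVecs (suc k) zero (zero ∷ v) no-two e = ∈-map⁺ (zero ∷_) (∈-weightVecs k zero v (λ i → no-two (suc i)) e)
∈-weightVecs (suc k) (suc s) (zero ∷ v) no-two e =
  ∈-++⁺ˡ (∈-map⁺ (zero ∷_) (∈-weightVecs k (suc s) v (λ i → no-two (suc i)) e))
∈-weightVecs (suc k) (suc s) (suc zero ∷ v) no-two e =
  ∈-++⁺ʳ (map (zero ∷_) (weightVecs k (suc s))) (∈-map⁺ (suc zero ∷_) (∈-weightVecs k s v (λ i → no-two (suc i)) (suc-injective e)))
∈-weightVecs (suc k) s (suc (suc zero) ∷ v) no-two e = ⊥-elim (no-two zero refl)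

-- The definitions below branch on explicit decisions (j <? k, switch? j)
-- so that proofs can follow the same case split.

module Construction (k s : ℕ) where

  z : ℕ
  z = k ∸ s

  letter : ∀ {t} → Dec (t < z) → Fin 3
  letter (yes _) = zero₃
  letter (no _) = one₃

  w : ℕ → Fin 3
  w t = letter (t <? z)

  Switch : ℕ → Set
  Switch j = j ≡ z × 0 < z × z < k

  switch? : ∀ j → Dec (Switch j)
  switch? j = (j ≟ z) ×-dec ((0 <? z) ×-dec (z <? k))

  w≢two : ∀ t → w t ≢ two₃
  w≢two t with t <? z
  ... | yes _ = λ ()
  ... | no _ = λ ()

  toggle-w≢w : ∀ t → toggle (w t) ≢ w t
  toggle-w≢w t with t <? z
  ... | yes _ = λ ()
  ... | no _ = λ ()

  toggle-w≢two : ∀ t → toggle (w t) ≢ two₃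
  toggle-w≢two t with t <? z
  ... | yes _ = λ ()
  ... | no _ = λ ()

  w-constant : ∀ j → suc j ≢ z → w j ≡ w (suc j)
  w-constant j ne with j <? z | suc j <? z
  ... | yes _ | yes _ = refl
  ... | no _ | no _ = refl
  ... | yes j<z | no sj≮z = ⊥-elim (ne (≤-antisym j<z (≮⇒≥ sj≮z)))
  ... | no j≮z | yes sj<z = ⊥-elim (j≮z (<-trans (n<1+n j) sj<z))

  -- the non-advancing letter used at stay rows in state j: the toggle of the
  -- previous letter, which differs from w j except at the switch
  decoy : ℕ → Fin 3
  decoy j = toggle (w (pred j))

  decoy≢w : ∀ j → j < k → ¬ Switch j → decoy j ≢ w j
  decoy≢w zero j<k ¬switch = toggle-w≢w 0
  decoy≢w (suc j) j<k ¬switch e with suc j ≟ z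
  ... | yes sj≡z = ¬switch (sj≡z , subst (0 <_) sj≡z (s≤s z≤n) , subst (_< k) sj≡z j<k)
  ... | no ne = toggle-w≢w j (trans e (sym (w-constant j ne)))

  -- `Matches col b j`: on the rows selected by b, col reads exactly the
  -- rest w j … w (k ∸ 1) of the target word
  Matches : ∀ {m} → Vec (Fin 3) m → Vec Bool m → ℕ → Set
  Matches [] [] j = j ≡ k
  Matches (y ∷ col) (true ∷ b) j = j < k × y ≡ w j × Matches col b (suc j)
  Matches (y ∷ col) (false ∷ b) j = Matches col b j

  matches? : ∀ {m} (b : Vec Bool m) (j : ℕ) (col : Vec (Fin 3) m) → Dec (Matches col b j)
  matches? [] j [] = j ≟ k
  matches? (true ∷ b) j (y ∷ col) = (j <? k) ×-dec ((y FinP.≟ w j) ×-dec matches? b (suc j) col)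
  matches? (false ∷ b) j (y ∷ col) = matches? b j col

  -- `avoiders m j`: all columns of height m on which the greedy scan,
  -- started in state j, does not reach state k
  mutual
    avoiders : ∀ m → ℕ → List (Vec (Fin 3) m)
    avoiders zero j = avoiders₀ j (j <? k)
    avoiders (suc m) j = avoiders₊ m j (j <? k)

    avoiders₀ : ∀ j → Dec (j < k) → List (Vec (Fin 3) zero)
    avoiders₀ j (yes _) = [] ∷ []
    avoiders₀ j (no _) = []

    avoiders₊ : ∀ m j → Dec (j < k) → List (Vec (Fin 3) (suc m))
    avoiders₊ m j (yes _) =
      map (w j ∷_) (avoiders m (suc j)) ++ (map (two₃ ∷_) (avoiders m j) ++ map (toggle (w j) ∷_) (avoiders m j))
    avoiders₊ m j (no _) = []

  -- `extras m j q`: columns whose scan from state j ends in state k exactly,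
  -- about q per advance set; at non-switch stay rows the multiplicity is
  -- halved between the letters 2 and `decoy j`
  mutual
    extras : ∀ m → ℕ → ℕ → List (Vec (Fin 3) m)
    extras zero j q = extras₀ (j ≟ k) q
    extras (suc m) j q = extras-advance m j q (j <? k) ++ extras-stay m j q (switch? j)

    extras₀ : ∀ {j} → Dec (j ≡ k) → ℕ → List (Vec (Fin 3) zero)
    extras₀ (yes _) zero = []
    extras₀ (yes _) (suc q) = [] ∷ []
    extras₀ (no _) q = []

    extras-advance : ∀ m j q → Dec (j < k) → List (Vec (Fin 3) (suc m))
    extras-advance m j q (yes _) = map (w j ∷_) (extras m (suc j) q)
    extras-advance m j q (no _) = []

    extras-stay : ∀ m j q → Dec (Switch j) → List (Vec (Fin 3) (suc m))
    extras-stay m j q (yes _) = map (two₃ ∷_) (extras m j q)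
    extras-stay m j q (no _) = map (two₃ ∷_) (extras m j ⌈ q /2⌉) ++ map (decoy j ∷_) (extras m j ⌊ q /2⌋)

  -- `deficit m j a`: the number of advance sets (from state j) with fewer
  -- than a halving rows; only these can lose columns in `extras`
  mutual
    deficit : ℕ → ℕ → ℕ → ℕ
    deficit zero j a = deficit₀ (j ≟ k) a
    deficit (suc m) j a = deficit-advance m j a (j <? k) + deficit-stay m j a (switch? j)

    deficit₀ : ∀ {j} → Dec (j ≡ k) → ℕ → ℕ
    deficit₀ (yes _) zero = 0
    deficit₀ (yes _) (suc a) = 1
    deficit₀ (no _) a = 0

    deficit-advance : ∀ m j a → Dec (j < k) → ℕ
    deficit-advance m j a (yes _) = deficit m (suc j) a
    deficit-advance m j a (no _) = 0

    deficit-stay : ∀ m j a → Dec (Switch j) → ℕ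
    deficit-stay m j a (yes _) = deficit m j a
    deficit-stay m j a (no _) = deficit m j (a ∸ 1)

  wrong-letter : ∀ {m} (b : Vec Bool m) j (y : Fin 3) → y ≢ w j → ∀ (cols : List (Vec (Fin 3) m)) →
    count (matches? (true ∷ b) j) (map (y ∷_) cols) ≤ 0
  wrong-letter b j y y≢w cols = count-map-none (matches? (true ∷ b) j) (y ∷_) (λ _ p → y≢w (proj₁ (proj₂ p))) cols

  selected-≤ : ∀ {m} (b : Vec Bool m) j (y : Fin 3) (cols : List (Vec (Fin 3) m)) →
    count (matches? (true ∷ b) j) (map (y ∷_) cols) ≤ count (matches? b (suc j)) cols
  selected-≤ b j y cols = count-map-≤ (matches? (true ∷ b) j) (matches? b (suc j)) (y ∷_) (λ _ p → proj₂ (proj₂ p)) cols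

  unselected-≤ : ∀ {m} (b : Vec Bool m) j (y : Fin 3) (cols : List (Vec (Fin 3) m)) →
    count (matches? (false ∷ b) j) (map (y ∷_) cols) ≤ count (matches? b j) cols
  unselected-≤ b j y cols = count-map-≤ (matches? (false ∷ b) j) (matches? b j) (y ∷_) (λ _ p → p) cols

  avoiders-no-match : ∀ m j (b : Vec Bool m) j′ → j′ ≤ j → count (matches? b j′) (avoiders m j) ≤ 0
  avoiders-no-match zero j [] j′ j′≤j with j <? k
  ... | no _ = z≤n
  ... | yes j<k with j′ ≟ k
  ...   | yes j′≡k = ⊥-elim (<-irrefl j′≡k (≤-<-trans j′≤j j<k))
  ...   | no _ = z≤n
  avoiders-no-match (suc m) j (c ∷ b) j′ j′≤j with j <? k
  ... | no _ = z≤n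
  ... | yes j<k
    rewrite count-++ (matches? (c ∷ b) j′) (map (w j ∷_) (avoiders m (suc j)))
                     (map (two₃ ∷_) (avoiders m j) ++ map (toggle (w j) ∷_) (avoiders m j))
          | count-++ (matches? (c ∷ b) j′) (map (two₃ ∷_) (avoiders m j)) (map (toggle (w j) ∷_) (avoiders m j))
    = by-row c
    where
    by-row : ∀ c → count (matches? (c ∷ b) j′) (map (w j ∷_) (avoiders m (suc j))) +
                   (count (matches? (c ∷ b) j′) (map (two₃ ∷_) (avoiders m j)) +
                    count (matches? (c ∷ b) j′) (map (toggle (w j) ∷_) (avoiders m j))) ≤ 0
    by-row true = +-mono-≤ (≤-trans (selected-≤ b j′ (w j) (avoiders m (suc j))) (avoiders-no-match m (suc j) b (suc j′) (s≤s j′≤j)))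
                           (+-mono-≤ (wrong-letter b j′ two₃ (λ e → w≢two j′ (sym e)) (avoiders m j)) toggled)
      where
      toggled : count (matches? (true ∷ b) j′) (map (toggle (w j) ∷_) (avoiders m j)) ≤ 0
      toggled with m≤n⇒m<n∨m≡n j′≤j
      ... | inj₁ j′<j = ≤-trans (selected-≤ b j′ (toggle (w j)) (avoiders m j)) (avoiders-no-match m j b (suc j′) j′<j)
      ... | inj₂ refl = wrong-letter b j′ (toggle (w j)) (toggle-w≢w j) (avoiders m j)
    by-row false = +-mono-≤ (≤-trans (unselected-≤ b j′ (w j) (avoiders m (suc j)))
                                     (avoiders-no-match m (suc j) b j′ (m≤n⇒m≤1+n j′≤j)))
                            (+-mono-≤ (≤-trans (unselected-≤ b j′ two₃ (avoiders m j)) (avoiders-no-match m j b j′ j′≤j))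
                                      (≤-trans (unselected-≤ b j′ (toggle (w j)) (avoiders m j)) (avoiders-no-match m j b j′ j′≤j)))

  mutual
    extras-no-early-match : ∀ m j q (b : Vec Bool m) j′ → j′ < j → count (matches? b j′) (extras m j q) ≤ 0
    extras-no-early-match zero j q [] j′ j′<j with j ≟ k
    ... | no _ = z≤n
    extras-no-early-match zero j zero [] j′ j′<j | yes _ = z≤n
    extras-no-early-match zero j (suc q) [] j′ j′<j | yes j≡k with j′ ≟ k
    ... | yes j′≡k = ⊥-elim (<-irrefl (trans j′≡k (sym j≡k)) j′<j)
    ... | no _ = z≤n
    extras-no-early-match (suc m) j q (c ∷ b) j′ j′<j
      rewrite count-++ (matches? (c ∷ b) j′) (extras-advance m j q (j <? k)) (extras-stay m j q (switch? j)) =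
      +-mono-≤ (advance-no-early-match m j q (j <? k) b c j′ j′<j) (stay-no-early-match m j q (switch? j) b c j′ j′<j)

    advance-no-early-match : ∀ m j q d (b : Vec Bool m) c j′ → j′ < j →
      count (matches? (c ∷ b) j′) (extras-advance m j q d) ≤ 0
    advance-no-early-match m j q (no _) b c j′ j′<j = z≤n
    advance-no-early-match m j q (yes _) b true j′ j′<j =
      ≤-trans (selected-≤ b j′ (w j) (extras m (suc j) q)) (extras-no-early-match m (suc j) q b (suc j′) (s≤s j′<j))
    advance-no-early-match m j q (yes _) b false j′ j′<j =
      ≤-trans (unselected-≤ b j′ (w j) (extras m (suc j) q)) (extras-no-early-match m (suc j) q b j′ (m<n⇒m<1+n j′<j))

    stay-no-early-match : ∀ m j q d (b : Vec Bool m) c j′ → j′ < j →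
      count (matches? (c ∷ b) j′) (extras-stay m j q d) ≤ 0
    stay-no-early-match m j q (yes _) b true j′ j′<j = wrong-letter b j′ two₃ (λ e → w≢two j′ (sym e)) (extras m j q)
    stay-no-early-match m j q (yes _) b false j′ j′<j =
      ≤-trans (unselected-≤ b j′ two₃ (extras m j q)) (extras-no-early-match m j q b j′ j′<j)
    stay-no-early-match m j q (no _) b c j′ j′<j
      rewrite count-++ (matches? (c ∷ b) j′) (map (two₃ ∷_) (extras m j ⌈ q /2⌉)) (map (decoy j ∷_) (extras m j ⌊ q /2⌋)) =
      by-row c
      where
      by-row : ∀ c → count (matches? (c ∷ b) j′) (map (two₃ ∷_) (extras m j ⌈ q /2⌉)) +
                     count (matches? (c ∷ b) j′) (map (decoy j ∷_) (extras m j ⌊ q /2⌋)) ≤ 0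
      by-row true = +-mono-≤ (wrong-letter b j′ two₃ (λ e → w≢two j′ (sym e)) (extras m j ⌈ q /2⌉)) decoyed
        where
        decoyed : count (matches? (true ∷ b) j′) (map (decoy j ∷_) (extras m j ⌊ q /2⌋)) ≤ 0
        decoyed with m≤n⇒m<n∨m≡n j′<j
        ... | inj₁ 1+j′<j = ≤-trans (selected-≤ b j′ (decoy j) (extras m j ⌊ q /2⌋))
                                    (extras-no-early-match m j ⌊ q /2⌋ b (suc j′) 1+j′<j)
        ... | inj₂ refl = wrong-letter b j′ (decoy (suc j′)) (toggle-w≢w j′) (extras m (suc j′) ⌊ q /2⌋)
      by-row false =
        +-mono-≤ (≤-trans (unselected-≤ b j′ two₃ (extras m j ⌈ q /2⌉)) (extras-no-early-match m j ⌈ q /2⌉ b j′ j′<j))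
                 (≤-trans (unselected-≤ b j′ (decoy j) (extras m j ⌊ q /2⌋)) (extras-no-early-match m j ⌊ q /2⌋ b j′ j′<j))

  mutual
    extras-few-matches : ∀ m j q (b : Vec Bool m) → count (matches? b j) (extras m j q) ≤ q
    extras-few-matches zero j q [] with j ≟ k
    ... | no _ = z≤n
    extras-few-matches zero j zero [] | yes _ = z≤n
    extras-few-matches zero j (suc q) [] | yes _ with j ≟ k
    ... | yes _ = s≤s z≤n
    ... | no _ = z≤n
    extras-few-matches (suc m) j q (true ∷ b)
      rewrite count-++ (matches? (true ∷ b) j) (extras-advance m j q (j <? k)) (extras-stay m j q (switch? j)) =
      ≤-trans (+-mono-≤ (advance-selected m j q (j <? k) b) (stay-selected m j q (switch? j) b)) (≤-reflexive (+-identityʳ q))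
    extras-few-matches (suc m) j q (false ∷ b)
      rewrite count-++ (matches? (false ∷ b) j) (extras-advance m j q (j <? k)) (extras-stay m j q (switch? j)) =
      +-mono-≤ (advance-unselected m j q (j <? k) b) (stay-unselected m j q (switch? j) b)

    advance-selected : ∀ m j q d (b : Vec Bool m) → count (matches? (true ∷ b) j) (extras-advance m j q d) ≤ q
    advance-selected m j q (no _) b = z≤n
    advance-selected m j q (yes _) b = ≤-trans (selected-≤ b j (w j) (extras m (suc j) q)) (extras-few-matches m (suc j) q b)

    -- skipping an advancing row means the match would have to start later
    advance-unselected : ∀ m j q d (b : Vec Bool m) → count (matches? (false ∷ b) j) (extras-advance m j q d) ≤ 0
    advance-unselected m j q (no _) b = z≤n
    advance-unselected m j q (yes _) b = ≤-trans (unselected-≤ b j (w j) (extras m (suc j) q)) (extras-no-early-match m (suc j) q b j (n<1+n j))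

    -- a selected stay row carries 2 or a decoy, neither of which is w j
    stay-selected : ∀ m j q d (b : Vec Bool m) → count (matches? (true ∷ b) j) (extras-stay m j q d) ≤ 0
    stay-selected m j q (yes _) b = wrong-letter b j two₃ (λ e → w≢two j (sym e)) (extras m j q)
    stay-selected m j q (no ¬switch) b
      rewrite count-++ (matches? (true ∷ b) j) (map (two₃ ∷_) (extras m j ⌈ q /2⌉)) (map (decoy j ∷_) (extras m j ⌊ q /2⌋)) =
      +-mono-≤ (wrong-letter b j two₃ (λ e → w≢two j (sym e)) (extras m j ⌈ q /2⌉))
               (count-map-none (matches? (true ∷ b) j) (decoy j ∷_)
                               (λ _ p → decoy≢w j (proj₁ p) ¬switch (proj₁ (proj₂ p))) (extras m j ⌊ q /2⌋))

    stay-unselected : ∀ m j q d (b : Vec Bool m) → count (matches? (false ∷ b) j) (extras-stay m j q d) ≤ q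
    stay-unselected m j q (yes _) b = ≤-trans (unselected-≤ b j two₃ (extras m j q)) (extras-few-matches m j q b)
    stay-unselected m j q (no _) b
      rewrite count-++ (matches? (false ∷ b) j) (map (two₃ ∷_) (extras m j ⌈ q /2⌉)) (map (decoy j ∷_) (extras m j ⌊ q /2⌋)) =
      ≤-trans (+-mono-≤ (≤-trans (unselected-≤ b j two₃ (extras m j ⌈ q /2⌉)) (extras-few-matches m j ⌈ q /2⌉ b))
                        (≤-trans (unselected-≤ b j (decoy j) (extras m j ⌊ q /2⌋)) (extras-few-matches m j ⌊ q /2⌋ b)))
              (≤-reflexive (⌈q/2⌉+⌊q/2⌋≡q q))

  construction : ∀ m → ℕ → List (Vec (Fin 3) m)
  construction m q = avoiders m 0 ++ extras m 0 q

  construction-few-matches : ∀ m q (b : Vec Bool m) → count (matches? b 0) (construction m q) ≤ q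
  construction-few-matches m q b =
    ≤-trans (≤-reflexive (count-++ (matches? b 0) (avoiders m 0) (extras m 0 q)))
            (+-mono-≤ (avoiders-no-match m 0 b 0 z≤n) (extras-few-matches m 0 q b))

  -- Simplicity.  Columns are distinguished by their first letters, except
  -- that an avoider and an extra column cannot coincide because the latter
  -- matches some row selection.

  avoiders-unique : ∀ m j → Unique (avoiders m j)
  avoiders-unique zero j with j <? k
  ... | yes _ = All.[] AllPairs.∷ AllPairs.[]
  ... | no _ = AllPairs.[]
  avoiders-unique (suc m) j with j <? k
  ... | no _ = AllPairs.[]
  ... | yes _ =
    Unique.++⁺ (unique-prefixed (w j) (avoiders-unique m (suc j)))
      (Unique.++⁺ (unique-prefixed two₃ (avoiders-unique m j)) (unique-prefixed (toggle (w j)) (avoiders-unique m j))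
        (disjoint-prefixed (λ e → toggle-w≢two j (sym e)) (avoiders m j) (avoiders m j)))
      (disjoint-++ʳ (disjoint-prefixed (w≢two j) (avoiders m (suc j)) (avoiders m j))
                    (disjoint-prefixed (λ e → toggle-w≢w j (sym e)) (avoiders m (suc j)) (avoiders m j)))

  mutual
    extras-unique : ∀ m j q → Unique (extras m j q)
    extras-unique zero j q with j ≟ k
    ... | no _ = AllPairs.[]
    extras-unique zero j zero | yes _ = AllPairs.[]
    extras-unique zero j (suc q) | yes _ = All.[] AllPairs.∷ AllPairs.[]
    extras-unique (suc m) j q =
      Unique.++⁺ (advance-unique m j q (j <? k)) (stay-unique m j q (switch? j)) (advance-stay-disjoint m j q (j <? k) (switch? j))

    advance-unique : ∀ m j q d → Unique (extras-advance m j q d)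
    advance-unique m j q (yes _) = unique-prefixed (w j) (extras-unique m (suc j) q)
    advance-unique m j q (no _) = AllPairs.[]

    stay-unique : ∀ m j q d → Unique (extras-stay m j q d)
    stay-unique m j q (yes _) = unique-prefixed two₃ (extras-unique m j q)
    stay-unique m j q (no _) =
      Unique.++⁺ (unique-prefixed two₃ (extras-unique m j ⌈ q /2⌉)) (unique-prefixed (decoy j) (extras-unique m j ⌊ q /2⌋))
        (disjoint-prefixed (λ e → toggle-w≢two (pred j) (sym e)) (extras m j ⌈ q /2⌉) (extras m j ⌊ q /2⌋))

    advance-stay-disjoint : ∀ m j q d e → Disjoint (extras-advance m j q d) (extras-stay m j q e)
    advance-stay-disjoint m j q (no _) e (() , _)
    advance-stay-disjoint m j q (yes _) (yes _) = disjoint-prefixed (w≢two j) (extras m (suc j) q) (extras m j q)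
    advance-stay-disjoint m j q (yes j<k) (no ¬switch) =
      disjoint-++ʳ (disjoint-prefixed (w≢two j) (extras m (suc j) q) (extras m j ⌈ q /2⌉))
                   (disjoint-prefixed (λ e → decoy≢w j j<k ¬switch (sym e)) (extras m (suc j) q) (extras m j ⌊ q /2⌋))

  mutual
    extras-match : ∀ m j q {col} → col ∈ extras m j q → Σ (Vec Bool m) λ b → Matches col b j
    extras-match zero j q col∈ with j ≟ k
    extras-match zero j zero () | yes _
    extras-match zero j (suc q) (here refl) | yes j≡k = [] , j≡k
    extras-match (suc m) j q col∈ with ∈-++⁻ (extras-advance m j q (j <? k)) col∈
    ... | inj₁ col∈′ = advance-match m j q (j <? k) col∈′
    ... | inj₂ col∈′ = stay-match m j q (switch? j) col∈′

    advance-match : ∀ m j q d {col} → col ∈ extras-advance m j q d → Σ (Vec Bool (suc m)) λ b → Matches col b j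
    advance-match m j q (yes j<k) col∈ with ∈-map⁻ (w j ∷_) col∈
    ... | _ , tail∈ , refl with extras-match m (suc j) q tail∈
    ...   | b , tail-matches = true ∷ b , j<k , refl , tail-matches

    stay-match : ∀ m j q d {col} → col ∈ extras-stay m j q d → Σ (Vec Bool (suc m)) λ b → Matches col b j
    stay-match m j q (yes _) col∈ with ∈-map⁻ (two₃ ∷_) col∈
    ... | _ , tail∈ , refl with extras-match m j q tail∈
    ...   | b , tail-matches = false ∷ b , tail-matches
    stay-match m j q (no _) col∈ with ∈-++⁻ (map (two₃ ∷_) (extras m j ⌈ q /2⌉)) col∈
    ... | inj₁ col∈′ with ∈-map⁻ (two₃ ∷_) col∈′
    ...   | _ , tail∈ , refl with extras-match m j ⌈ q /2⌉ tail∈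
    ...     | b , tail-matches = false ∷ b , tail-matches
    stay-match m j q (no _) col∈ | inj₂ col∈′ with ∈-map⁻ (decoy j ∷_) col∈′
    ...   | _ , tail∈ , refl with extras-match m j ⌊ q /2⌋ tail∈
    ...     | b , tail-matches = false ∷ b , tail-matches

  construction-unique : ∀ m q → Unique (construction m q)
  construction-unique m q = Unique.++⁺ (avoiders-unique m 0) (extras-unique m 0 q) avoiders-extras-disjoint
    where
    avoiders-extras-disjoint : Disjoint (avoiders m 0) (extras m 0 q)
    avoiders-extras-disjoint (col∈avoiders , col∈extras) with extras-match m 0 q col∈extras
    ... | b , col-matches =
      1+n≰n (≤-trans (count-∈ (matches? b 0) col∈avoiders col-matches) (avoiders-no-match m 0 b 0 z≤n))

  avoiders-length : ∀ m j → length (avoiders m j) ≡ avoiderCount m (k ∸ j)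
  avoiders-length zero j with j <? k
  ... | yes j<k rewrite k∸j≡suc[k∸sucj] j<k = sym (avoiderCount-empty (k ∸ suc j))
  ... | no j≮k rewrite m≤n⇒m∸n≡0 (≮⇒≥ j≮k) = refl
  avoiders-length (suc m) j with j <? k
  ... | no j≮k rewrite m≤n⇒m∸n≡0 (≮⇒≥ j≮k) = refl
  ... | yes j<k = begin
      length (map (w j ∷_) (avoiders m (suc j)) ++ (map (two₃ ∷_) (avoiders m j) ++ map (toggle (w j) ∷_) (avoiders m j)))
    ≡⟨ length-++ (map (w j ∷_) (avoiders m (suc j))) ⟩
      length (map (w j ∷_) (avoiders m (suc j))) + length (map (two₃ ∷_) (avoiders m j) ++ map (toggle (w j) ∷_) (avoiders m j))
    ≡⟨ cong₂ _+_ (length-map (w j ∷_) (avoiders m (suc j)))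
                 (trans (length-++ (map (two₃ ∷_) (avoiders m j))) (cong₂ _+_ (length-map _ (avoiders m j)) (length-map _ (avoiders m j)))) ⟩
      length (avoiders m (suc j)) + (length (avoiders m j) + length (avoiders m j))
    ≡⟨ cong₂ _+_ (avoiders-length m (suc j)) (cong₂ _+_ (avoiders-length m j) (avoiders-length m j)) ⟩
      T m n + (T m (k ∸ j) + T m (k ∸ j))
    ≡⟨ cong (λ x → T m n + (T m x + T m x)) (k∸j≡suc[k∸sucj] j<k) ⟩
      T m n + (T m (suc n) + T m (suc n))
    ≡⟨ cong (λ x → T m n + (T m (suc n) + x)) (sym (+-identityʳ _)) ⟩
      T m n + 2 * T m (suc n)
    ≡⟨ sym (avoiderCount-step m n) ⟩
      T (suc m) (suc n)
    ≡⟨ cong (T (suc m)) (sym (k∸j≡suc[k∸sucj] j<k)) ⟩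
      T (suc m) (k ∸ j)
    ∎
    where
    open ≡-Reasoning
    T : ℕ → ℕ → ℕ
    T = avoiderCount
    n : ℕ
    n = k ∸ suc j

  -- Size of the extras: each advance set contributes q columns, except that
  -- an advance set counted in the deficit may contribute fewer.

  extras₀-length : ∀ q a → q ≤ 2 ^ a → q * 1 ≤ length (extras₀ {k} (yes refl) q) + q * deficit₀ {k} (yes refl) a
  extras₀-length zero a _ = z≤n
  extras₀-length (suc zero) zero _ = s≤s z≤n
  extras₀-length (suc (suc q)) zero (s≤s ())
  extras₀-length (suc q) (suc a) _ = m≤n+m (suc q * 1) 1

  mutual
    extras-length : ∀ m j q a → j ≤ k → q ≤ 2 ^ a → q * (m C (k ∸ j)) ≤ length (extras m j q) + q * deficit m j a
    extras-length zero j q a j≤k q≤ with j ≟ k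
    ... | yes refl rewrite n∸n≡0 j = extras₀-length q a q≤
    ... | no j≢k rewrite k∸j≡suc[k∸sucj] (≤∧≢⇒< j≤k j≢k) | *-zeroʳ q = z≤n
    extras-length (suc m) j q a j≤k q≤
      rewrite length-++ (extras-advance m j q (j <? k)) {extras-stay m j q (switch? j)} = by-state (j <? k)
      where
      F dF : ℕ
      F = length (extras-stay m j q (switch? j))
      dF = deficit-stay m j a (switch? j)
      stay : q * (m C (k ∸ j)) ≤ F + q * dF
      stay = stay-length m j q a (switch? j) j≤k q≤
      by-state : (d : Dec (j < k)) →
        q * (suc m C (k ∸ j)) ≤ (length (extras-advance m j q d) + F) + q * (deficit-advance m j a d + dF)
      by-state (yes j<k) = begin
          q * (suc m C (k ∸ j))
        ≡⟨ cong (λ x → q * (suc m C x)) (k∸j≡suc[k∸sucj] j<k) ⟩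
          q * (suc m C suc n)
        ≡⟨ cong (q *_) (sym (nCk+nC[k+1]≡[n+1]C[k+1] m n)) ⟩
          q * (m C n + m C suc n)
        ≡⟨ *-distribˡ-+ q (m C n) (m C suc n) ⟩
          q * (m C n) + q * (m C suc n)
        ≤⟨ +-mono-≤-interchange A (q * dA) F (q * dF) advance (subst (λ x → q * (m C x) ≤ F + q * dF) (k∸j≡suc[k∸sucj] j<k) stay) ⟩
          (A + F) + (q * dA + q * dF)
        ≡⟨ cong ((A + F) +_) (sym (*-distribˡ-+ q dA dF)) ⟩
          (A + F) + q * (dA + dF)
        ∎
        where
        open ≤-Reasoning
        n A dA : ℕ
        n = k ∸ suc j
        A = length (map (w j ∷_) (extras m (suc j) q))
        dA = deficit m (suc j) a
        advance : q * (m C n) ≤ A + q * dA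
        advance = subst (λ x → q * (m C n) ≤ x + q * dA) (sym (length-map (w j ∷_) (extras m (suc j) q)))
                        (extras-length m (suc j) q a j<k q≤)
      -- in the final state only stay rows remain, and C(m+1,0) = C(m,0)
      by-state (no j≮k) with ≤-antisym j≤k (≮⇒≥ j≮k)
      ... | refl rewrite n∸n≡0 j = subst (λ x → q * (m C x) ≤ F + q * dF) (n∸n≡0 j) stay

    stay-length : ∀ m j q a d → j ≤ k → q ≤ 2 ^ a →
      q * (m C (k ∸ j)) ≤ length (extras-stay m j q d) + q * deficit-stay m j a d
    stay-length m j q a (yes _) j≤k q≤ =
      subst (λ x → q * (m C (k ∸ j)) ≤ x + q * deficit m j a) (sym (length-map (two₃ ∷_) (extras m j q)))
            (extras-length m j q a j≤k q≤)
    stay-length m j q a (no _) j≤k q≤ = begin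
        q * c
      ≡⟨ cong (_* c) (sym (⌈q/2⌉+⌊q/2⌋≡q q)) ⟩
        (⌈ q /2⌉ + ⌊ q /2⌋) * c
      ≡⟨ *-distribʳ-+ c ⌈ q /2⌉ ⌊ q /2⌋ ⟩
        ⌈ q /2⌉ * c + ⌊ q /2⌋ * c
      ≤⟨ +-mono-≤-interchange (length (extras m j ⌈ q /2⌉)) (⌈ q /2⌉ * d) (length (extras m j ⌊ q /2⌋)) (⌊ q /2⌋ * d)
           (extras-length m j ⌈ q /2⌉ (a ∸ 1) j≤k (⌈q/2⌉≤2^[a∸1] q a q≤))
           (extras-length m j ⌊ q /2⌋ (a ∸ 1) j≤k (⌊q/2⌋≤2^[a∸1] q a q≤)) ⟩
        (length (extras m j ⌈ q /2⌉) + length (extras m j ⌊ q /2⌋)) + (⌈ q /2⌉ * d + ⌊ q /2⌋ * d)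
      ≡⟨ cong₂ _+_ (sym stay-columns) (trans (sym (*-distribʳ-+ d ⌈ q /2⌉ ⌊ q /2⌋)) (cong (_* d) (⌈q/2⌉+⌊q/2⌋≡q q))) ⟩
        length (map (two₃ ∷_) (extras m j ⌈ q /2⌉) ++ map (decoy j ∷_) (extras m j ⌊ q /2⌋)) + q * d
      ∎
      where
      open ≤-Reasoning
      c d : ℕ
      c = m C (k ∸ j)
      d = deficit m j (a ∸ 1)
      stay-columns : length (map (two₃ ∷_) (extras m j ⌈ q /2⌉) ++ map (decoy j ∷_) (extras m j ⌊ q /2⌋))
                     ≡ length (extras m j ⌈ q /2⌉) + length (extras m j ⌊ q /2⌋)
      stay-columns = trans (length-++ (map (two₃ ∷_) (extras m j ⌈ q /2⌉)))
                           (cong₂ _+_ (length-map (two₃ ∷_) (extras m j ⌈ q /2⌉)) (length-map (decoy j ∷_) (extras m j ⌊ q /2⌋)))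

  deficit-zero : ∀ m j → deficit m j 0 ≡ 0
  deficit-zero zero j with j ≟ k
  ... | yes _ = refl
  ... | no _ = refl
  deficit-zero (suc m) j = cong₂ _+_ (advance (j <? k)) (stay (switch? j))
    where
    advance : ∀ d → deficit-advance m j 0 d ≡ 0
    advance (yes _) = deficit-zero m (suc j)
    advance (no _) = refl
    stay : ∀ d → deficit-stay m j 0 d ≡ 0
    stay (yes _) = deficit-zero m j
    stay (no _) = deficit-zero m j

  -- The deficit counts some of the C(m, k ∸ j) advance sets.
  deficit≤C : ∀ m j a → j ≤ k → deficit m j a ≤ m C (k ∸ j)
  deficit≤C zero j a j≤k with j ≟ k
  deficit≤C zero j zero j≤k | yes _ = z≤n
  deficit≤C zero j (suc a) j≤k | yes refl rewrite n∸n≡0 j = ≤-refl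
  ... | no j≢k = z≤n
  deficit≤C (suc m) j a j≤k = by-state (j <? k)
    where
    stay : ∀ d → deficit-stay m j a d ≤ m C (k ∸ j)
    stay (yes _) = deficit≤C m j a j≤k
    stay (no _) = deficit≤C m j (a ∸ 1) j≤k
    by-state : ∀ d → deficit-advance m j a d + deficit-stay m j a (switch? j) ≤ suc m C (k ∸ j)
    by-state (yes j<k) =
      ≤-trans (+-mono-≤ (deficit≤C m (suc j) a j<k)
                        (subst (λ x → deficit-stay m j a (switch? j) ≤ m C x) (k∸j≡suc[k∸sucj] j<k) (stay (switch? j))))
              (≤-reflexive (trans (nCk+nC[k+1]≡[n+1]C[k+1] m (k ∸ suc j)) (cong (suc m C_) (sym (k∸j≡suc[k∸sucj] j<k)))))
    by-state (no j≮k) with ≤-antisym j≤k (≮⇒≥ j≮k)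
    ... | refl = ≤-trans (subst (λ x → deficit-stay m j a (switch? j) ≤ m C x) (n∸n≡0 j) (stay (switch? j)))
                         (≤-reflexive (cong (suc m C_) (sym (n∸n≡0 j))))

  NoSwitchFrom : ℕ → Set
  NoSwitchFrom j = ∀ j′ → j ≤ j′ → ¬ Switch j′

  -- Without a switch ahead, every stay row halves, and an advance set from
  -- state j leaves m ∸ (k ∸ j) ≥ a stay rows: the deficit vanishes.
  deficit-vanishes : ∀ m j a → NoSwitchFrom j → j ≤ k → (k ∸ j) + a ≤ m → deficit m j a ≡ 0
  deficit-vanishes zero j zero _ _ _ = deficit-zero zero j
  deficit-vanishes zero j (suc a) _ _ ≤0 = ⊥-elim (1+n≰n (≤-trans (≤-reflexive (sym (+-suc (k ∸ j) a))) (≤-trans ≤0 z≤n)))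
  deficit-vanishes (suc m) j a no-switch j≤k ≤m = cong₂ _+_ (advance (j <? k)) (stay (switch? j))
    where
    advance : ∀ d → deficit-advance m j a d ≡ 0
    advance (yes j<k) = deficit-vanishes m (suc j) a (λ j′ le → no-switch j′ (≤-trans (n≤1+n j) le)) j<k
                          (≤-pred (subst (λ x → x + a ≤ suc m) (k∸j≡suc[k∸sucj] j<k) ≤m))
    advance (no _) = refl
    halved : ∀ a → (k ∸ j) + a ≤ suc m → deficit m j (a ∸ 1) ≡ 0
    halved zero _ = deficit-zero m j
    halved (suc a′) ≤m = deficit-vanishes m j a′ no-switch j≤k (≤-pred (subst (_≤ suc m) (+-suc (k ∸ j) a′) ≤m))
    stay : ∀ d → deficit-stay m j a d ≡ 0
    stay (yes switch) = ⊥-elim (no-switch j ≤-refl switch)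
    stay (no _) = halved a ≤m

  deficit-bound-no-switch : ∀ m a → NoSwitchFrom 0 → deficit m 0 (suc a) ≤ (k + a) C k
  deficit-bound-no-switch m a no-switch with m ≤? k + a
  ... | yes m≤ = ≤-trans (deficit≤C m 0 (suc a) z≤n) (C-monoˡ k m≤)
  ... | no m≰ rewrite deficit-vanishes m 0 (suc a) no-switch z≤n (subst (_≤ m) (sym (+-suc k a)) (≰⇒> m≰)) = z≤n

  -- With a switch at z (0 < z < k), the stay rows at the switch do not
  -- halve; counting advance sets by the rows where halving happens gives
  -- the bound C(k ∸ j + a, k ∸ j) before the switch.
  module WithSwitch (0<z : 0 < z) (z<k : z < k) where
    -- the number of 1s still to be read at the switch
    n₁ : ℕ
    n₁ = k ∸ z

    no-switch-after : NoSwitchFrom (suc z)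
    no-switch-after j′ le (e , _) = <-irrefl (sym e) le

    switch : Switch z
    switch = refl , 0<z , z<k

    deficit-at-switch′ : ∀ a d → deficit (n₁ + a + d) z (suc a) ≤ (n₁ + a) C n₁
    deficit-at-switch′ a zero = subst (λ x → deficit x z (suc a) ≤ (n₁ + a) C n₁) (sym (+-identityʳ (n₁ + a)))
                                      (deficit≤C (n₁ + a) z (suc a) (<⇒≤ z<k))
    deficit-at-switch′ a (suc d) rewrite +-suc (n₁ + a) d = by-state (z <? k) (switch? z)
      where
      M : ℕ
      M = n₁ + a + d
      by-state : ∀ d₁ d₂ → deficit-advance M z (suc a) d₁ + deficit-stay M z (suc a) d₂ ≤ (n₁ + a) C n₁
      by-state (no z≮k) _ = ⊥-elim (z≮k z<k)
      by-state _ (no ¬switch) = ⊥-elim (¬switch switch)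
      by-state (yes _) (yes _)
        rewrite deficit-vanishes M (suc z) (suc a) no-switch-after z<k
                  (subst (_≤ M) (sym (trans (+-suc (k ∸ suc z) a) (cong (_+ a) (sym (k∸j≡suc[k∸sucj] z<k))))) (m≤m+n (n₁ + a) d))
        = deficit-at-switch′ a d

    deficit-at-switch : ∀ a m → deficit m z (suc a) ≤ (n₁ + a) C n₁
    deficit-at-switch a m with m ≤? n₁ + a
    ... | yes m≤ = ≤-trans (deficit≤C m z (suc a) (<⇒≤ z<k)) (C-monoˡ n₁ m≤)
    ... | no m≰ with m≤n⇒∃[o]m+o≡n (<⇒≤ (≰⇒> m≰))
    ...   | d , refl = deficit-at-switch′ a d

    deficit-before-switch : ∀ m j a → j < z → deficit m j (suc a) ≤ (k ∸ j + a) C (k ∸ j)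
    deficit-before-switch zero j a j<z with j ≟ k
    ... | yes refl = ⊥-elim (<-asym j<z z<k)
    ... | no _ = z≤n
    deficit-before-switch (suc m) j a j<z = by-state (j <? k) (switch? j)
      where
      j<k : j < k
      j<k = <-trans j<z z<k
      n : ℕ
      n = k ∸ suc j
      advance : deficit m (suc j) (suc a) ≤ (n + a) C n
      advance with m≤n⇒m<n∨m≡n j<z
      ... | inj₁ 1+j<z = deficit-before-switch m (suc j) a 1+j<z
      ... | inj₂ e = subst (λ x → deficit m x (suc a) ≤ ((k ∸ x) + a) C (k ∸ x)) (sym e) (deficit-at-switch a m)
      stay : ∀ a → deficit m j a ≤ (n + a) C suc n
      stay zero rewrite deficit-zero m j = z≤n
      stay (suc a′) =
        ≤-trans (subst (λ x → deficit m j (suc a′) ≤ (x + a′) C x) (k∸j≡suc[k∸sucj] j<k) (deficit-before-switch m j a′ j<z))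
                              (≤-reflexive (cong (_C suc n) (sym (+-suc n a′))))
      by-state : ∀ d₁ d₂ → deficit-advance m j (suc a) d₁ + deficit-stay m j (suc a) d₂ ≤ (k ∸ j + a) C (k ∸ j)
      by-state (no j≮k) _ = ⊥-elim (j≮k j<k)
      by-state _ (yes (e , _)) = ⊥-elim (<-irrefl e j<z)
      by-state (yes _) (no _) = ≤-trans (+-mono-≤ advance (stay a))
        (≤-reflexive (trans (nCk+nC[k+1]≡[n+1]C[k+1] (n + a) n)
                            (cong₂ (λ x y → (x + a) C y) (sym (k∸j≡suc[k∸sucj] j<k)) (sym (k∸j≡suc[k∸sucj] j<k)))))

  deficit-bound : ∀ m a → deficit m 0 a ≤ (k + a ∸ 1) C k
  deficit-bound m zero rewrite deficit-zero m 0 = z≤n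
  deficit-bound m (suc a) rewrite +-suc k a with 0 <? z | z <? k
  ... | yes 0<z | yes z<k = WithSwitch.deficit-before-switch 0<z z<k m 0 a 0<z
  ... | no 0≮z | _ = deficit-bound-no-switch m a (λ _ _ (_ , 0<z , _) → 0≮z 0<z)
  ... | yes _ | no z≮k = deficit-bound-no-switch m a (λ _ _ (_ , _ , z<k) → z≮k z<k)

  construction-length : ∀ m q → length (construction m q) ≡ avoiderCount m k + length (extras m 0 q)
  construction-length m q = trans (length-++ (avoiders m 0)) (cong (_+ length (extras m 0 q)) (avoiders-length m 0))

  extras-size : ∀ m q → q * (m C k) ≤ length (extras m 0 q) + q * ((k + ⌈log₂ q ⌉ ∸ 1) C k)
  extras-size m q =
    ≤-trans (extras-length m 0 q a z≤n (n≤2^⌈log₂n⌉ q))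
            (+-monoʳ-≤ (length (extras m 0 q)) (*-monoʳ-≤ q (deficit-bound m a)))
    where
    a : ℕ
    a = ⌈log₂ q ⌉

  -- From containment to matches.  Label the selected rows with w 0, w 1, …
  -- in increasing order (other rows get 2).

  label : ∀ {m} → Vec Bool m → ℕ → Vec (Fin 3) m
  label [] j = []
  label (true ∷ b) j = w j ∷ label b (suc j)
  label (false ∷ b) j = two₃ ∷ label b j

  label-no-two : ∀ {m} (b : Vec Bool m) j x → Vec.lookup b x ≡ true → Vec.lookup (label b j) x ≢ two₃
  label-no-two (true ∷ b) j zero _ = w≢two j
  label-no-two (true ∷ b) j (suc x) e = label-no-two b (suc j) x e
  label-no-two (false ∷ b) j (suc x) e = label-no-two b j x e

  agrees⇒matches : ∀ {m} (col : Vec (Fin 3) m) (b : Vec Bool m) j →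
    (∀ x → Vec.lookup b x ≡ true → Vec.lookup col x ≡ Vec.lookup (label b j) x) → j + countTrue b ≡ k → Matches col b j
  agrees⇒matches [] [] j _ e = trans (sym (+-identityʳ j)) e
  agrees⇒matches (y ∷ col) (true ∷ b) j agrees e =
    ≤-trans (s≤s (m≤m+n j (countTrue b))) (≤-reflexive e′) ,
    agrees zero refl ,
    agrees⇒matches col b (suc j) (λ x → agrees (suc x)) e′
    where
    e′ : suc j + countTrue b ≡ k
    e′ = trans (sym (+-suc j (countTrue b))) e
  agrees⇒matches (y ∷ col) (false ∷ b) j agrees e = agrees⇒matches col b j (λ x → agrees (suc x)) e

  onesInWord : ℕ → ℕ → ℕ
  onesInWord j zero = 0
  onesInWord j (suc n) = isOne (w j) + onesInWord (suc j) n

  ones-label : ∀ {m} (b : Vec Bool m) j →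
    sum (λ x → ifSet (Vec.lookup b x) (isOne (Vec.lookup (label b j) x))) ≡ onesInWord j (countTrue b)
  ones-label [] j = refl
  ones-label (true ∷ b) j = cong (isOne (w j) +_) (ones-label b (suc j))
  ones-label (false ∷ b) j = ones-label b j

  onesInWord-1s : ∀ j n → z ≤ j → onesInWord j n ≡ n
  onesInWord-1s j zero _ = refl
  onesInWord-1s j (suc n) z≤j with j <? z
  ... | yes j<z = ⊥-elim (<-irrefl refl (≤-<-trans z≤j j<z))
  ... | no _ = cong suc (onesInWord-1s (suc j) n (m≤n⇒m≤1+n z≤j))

  onesInWord-0s : ∀ z′ j n → j + z′ ≡ z → onesInWord j (z′ + n) ≡ onesInWord z n
  onesInWord-0s zero j n e = cong (λ t → onesInWord t n) (trans (sym (+-identityʳ j)) e)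
  onesInWord-0s (suc z′) j n e with j <? z
  ... | yes _ = onesInWord-0s z′ (suc j) n (trans (sym (+-suc j z′)) e)
  ... | no j≮z = ⊥-elim (j≮z (≤-trans (s≤s (m≤m+n j z′)) (≤-reflexive (trans (sym (+-suc j z′)) e))))

  onesInWord-target : s ≤ k → onesInWord 0 k ≡ s
  onesInWord-target s≤k =
    trans (cong (onesInWord 0) (sym (m∸n+n≡m s≤k))) (trans (onesInWord-0s z 0 s refl) (onesInWord-1s z s ≤-refl))

  -- If A contains p·K_k^s on rows r, then p columns of A match the image of r:
  -- reading the labelling through r gives a column v of K_k^s, whose p
  -- copies are sent by c to columns agreeing with the labelling.
  contains⇒matches : ∀ {m} p (A : Matrix3 m) → s ≤ k → Contains (copies p (K k s)) A →
    Σ (Vec Bool m) λ b → p ≤ count (matches? b 0) A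
  contains⇒matches {m} p A s≤k (r , r-inj , c , c-inj , entries) =
    selected , count-≥-injection (matches? selected 0) A p g (λ eq → e-inj (c-inj eq)) g-matches
    where
    selected : Vec Bool m
    selected = tabulate (inImage r)
    L : Vec (Fin 3) m
    L = label selected 0
    v : Vec (Fin 3) k
    v = tabulate (λ i → Vec.lookup L (r i))
    selected-lookup : ∀ x → Vec.lookup selected x ≡ inImage r x
    selected-lookup = lookup∘tabulate (inImage r)
    selected-size : countTrue selected ≡ k
    selected-size = trans (countTrue-tabulate (inImage r)) (trans (sym (sum-injection r r-inj (λ _ → 1))) (sum-ones k))
    v-no-two : ∀ i → Vec.lookup v i ≢ two₃
    v-no-two i e = label-no-two selected 0 (r i) (trans (selected-lookup (r i)) (inImage-complete r i))
                                (trans (sym (lookup∘tabulate _ i)) e)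
    v-ones : ones v ≡ s
    v-ones = begin
        ones v
      ≡⟨ ones-tabulate (λ i → Vec.lookup L (r i)) ⟩
        sum (λ i → isOne (Vec.lookup L (r i)))
      ≡⟨ sum-injection r r-inj (λ x → isOne (Vec.lookup L x)) ⟩
        sum (λ x → ifSet (inImage r x) (isOne (Vec.lookup L x)))
      ≡⟨ sum-cong-≗ (λ x → cong (λ b → ifSet b (isOne (Vec.lookup L x))) (sym (selected-lookup x))) ⟩
        sum (λ x → ifSet (Vec.lookup selected x) (isOne (Vec.lookup L x)))
      ≡⟨ ones-label selected 0 ⟩
        onesInWord 0 (countTrue selected)
      ≡⟨ cong (onesInWord 0) selected-size ⟩
        onesInWord 0 k
      ≡⟨ onesInWord-target s≤k ⟩
        s
      ∎
      where open ≡-Reasoning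
    v∈K : v ∈ K k s
    v∈K = ∈-weightVecs k s v v-no-two v-ones
    e : Fin p → Fin (length (copies p (K k s)))
    e = proj₁ (∈-copies (K k s) v∈K p)
    e-inj : Injective _≡_ _≡_ e
    e-inj = proj₁ (proj₂ (∈-copies (K k s) v∈K p))
    e-lookup : ∀ t → lookup (copies p (K k s)) (e t) ≡ v
    e-lookup = proj₂ (proj₂ (∈-copies (K k s) v∈K p))
    g : Fin p → Fin (length A)
    g t = c (e t)
    g-matches : ∀ t → Matches (lookup A (g t)) selected 0
    g-matches t = agrees⇒matches (lookup A (g t)) selected 0 agrees selected-size
      where
      agrees : ∀ x → Vec.lookup selected x ≡ true → Vec.lookup (lookup A (g t)) x ≡ Vec.lookup L x
      agrees x x-selected with inImage-sound r x (trans (sym (selected-lookup x)) x-selected)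
      ... | i , refl = trans (entries i (e t)) (trans (cong (λ col → Vec.lookup col i) (e-lookup t)) (lookup∘tabulate _ i))

-- The theorem.  (The prefix operator +_ of ℤ is imported only here: above,
-- it would make sections such as (n +_) ambiguous.)

open import Data.Integer using (+_)

-- Integer form of the size estimate: the second summand of the bound may
-- be negative, so the natural-number inequality q·c ≤ h + q·d is moved to ℤ.
integer-bound : ∀ t q c d h → q * c ≤ h + q * d → + t ℤ.+ + q ℤ.* (+ c ℤ.- + d) ≤ℤ + (t + h)
integer-bound t q c d h q*c≤ = begin
    + t ℤ.+ + q ℤ.* (+ c ℤ.- + d)
  ≡⟨ expand (+ t) (+ q) (+ c) (+ d) ⟩
    (+ t ℤ.+ + q ℤ.* + c) ℤ.- + q ℤ.* + d
  ≡⟨ cong₂ ℤ._-_ (trans (cong (λ x → + t ℤ.+ x) (sym (ℤP.pos-* q c))) (sym (ℤP.pos-+ t (q * c)))) (sym (ℤP.pos-* q d)) ⟩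
    + (t + q * c) ℤ.- + (q * d)
  ≤⟨ ℤP.+-monoˡ-≤ (ℤ.- + (q * d)) (ℤ.+≤+ (+-monoʳ-≤ t q*c≤)) ⟩
    + (t + (h + q * d)) ℤ.- + (q * d)
  ≡⟨ cong (ℤ._- + (q * d)) (trans (cong +_ (sym (+-assoc t h (q * d)))) (ℤP.pos-+ (t + h) (q * d))) ⟩
    (+ (t + h) ℤ.+ + (q * d)) ℤ.- + (q * d)
  ≡⟨ cancel (+ (t + h)) (+ (q * d)) ⟩
    + (t + h)
  ∎
  where
  open ℤP.≤-Reasoning
  expand : ∀ (t q c d : ℤ) → t ℤ.+ q ℤ.* (c ℤ.- d) ≡ (t ℤ.+ q ℤ.* c) ℤ.- q ℤ.* d
  expand = ℤSolver.solve-∀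
  cancel : ∀ (x y : ℤ) → (x ℤ.+ y) ℤ.- y ≡ x
  cancel = ℤSolver.solve-∀

proposition3p5 : (p m k s : ℕ) → 1 < p → 1 ≤ m → s ≤ k → 1 ≤ k →
    Σ (Matrix3 m) λ A → Simple A × Avoids A (copies p (K k s)) ×
      (bound p m k ≤ℤ + ncols A)
proposition3p5 p m k s 1<p _ s≤k _ = A , construction-unique m q , avoids , large
  where
  open Construction k s
  q : ℕ
  q = p ∸ 1
  A : Matrix3 m
  A = construction m q
  -- p copies would give p matches, but every row set has at most q = p - 1
  avoids : Avoids A (copies p (K k s))
  avoids A-contains with contains⇒matches p A s≤k A-contains
  ... | b , p≤count = 1+n≰n (subst (_≤ q) p≡1+q (≤-trans p≤count (construction-few-matches m q b)))
    where
    p≡1+q : p ≡ suc q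
    p≡1+q = sym (trans (+-comm 1 q) (m∸n+n≡m (<⇒≤ 1<p)))
  -- |A| = Σ_{i<k} C(m,i) 2^(m-i) + |extras|, and |extras| ≥ q C(m,k) - q C(k+a-1,k)
  large : bound p m k ≤ℤ + ncols A
  large = subst (λ n → bound p m k ≤ℤ + n) (sym (construction-length m q))
                (integer-bound (avoiderCount m k) q (m C k) ((k + ⌈log₂ q ⌉ ∸ 1) C k) (length (extras m 0 q)) (extras-size m q))
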